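{- A finite simple graph $G$ satisfies $\mathrm{core}(G)=\mathrm{nucleus}(G)$ if and only if \[ \mathrm{core}(L_G^c)=\emptyset\quad\text{and}\quad \mathrm{diadem}(G)=\mathrm{corona}(G)\cap L(G). \]
   Context: For $X\subseteq V(G)$, $N(X)$ is the union of neighborhoods of the vertices of $X$. For a graph $H$, $\mathrm{core}(H)$ is the intersection of all maximum independent sets of $H$ (empty when $H$ has no vertices) and $\mathrm{corona}(H)$ their union. An independent set $I$ of $G$ is critical if $|I|-|N(I)|\ge|J|-|N(J)|$ for every independent set $J$; a maximum critical independent set is a critical independent set of maximum cardinality among critical independent sets; $\mathrm{nucleus}(G)$ is the intersection of all maximum critical independent sets and $\mathrm{diadem}(G)$ the union of all critical independent sets. $L(G)$ denotes the set $J\cup N(J)$ for any maximum critical independent set $J$ of $G$ (this set does not depend on the choice of $J$); $L^c(G)=V(G)-L(G)$ and $L_G^c=G[L^c(G)]$. -}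

module Defs where

open import Data.Nat using (ℕ; _≤_)
open import Data.Integer using (ℤ; +_; _-_) renaming (_≤_ to _≤ℤ_)
open import Data.Bool using (Bool; true; false; _∧_)
open import Data.Fin using (Fin)
open import Data.Fin.Subset using (Subset; _∈_; ∣_∣)
open import Data.Fin.Subset.Properties using (_∈?_)
open import Data.Fin.Properties using (any?)
open import Data.Vec using (tabulate)
open import Data.Product using (Σ; ∃; _×_; _,_)
open import Data.Sum using (_⊎_)
open import Data.Unit using (⊤)
open import Relation.Binary.PropositionalEquality using (_≡_)
open import Relation.Nullary using (¬_)
open import Relation.Nullary.Decidable using (⌊_⌋; _×-dec_)
open import Data.Bool.Properties using () renaming (_≟_ to _≟B_)

record Graph (n : ℕ) : Set where
  field
    adj    : Fin n → Fin n → Bool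
    sym    : ∀ u v → adj u v ≡ adj v u
    irrefl : ∀ v → adj v v ≡ false
open Graph public

-- Sets of vertices of G are decidable subsets Subset n.
-- Vertex predicates (possibly non-decidable sets of vertices):
VSet : ℕ → Set₁
VSet n = Fin n → Set

module _ {n : ℕ} (G : Graph n) where

  N : Subset n → Subset n
  N X = tabulate (λ v → ⌊ any? (λ u → (u ∈? X) ×-dec (adj G u v ≟B true)) ⌋)

  Independent : Subset n → Set
  Independent I = ∀ u v → u ∈ I → v ∈ I → adj G u v ≡ false

  -- Independent sets of the induced subgraph G[S]: independent sets of G
  -- contained in S.
  IndependentIn : VSet n → Subset n → Set
  IndependentIn S I = (∀ v → v ∈ I → S v) × Independent I

  MaximumIndependentIn : VSet n → Subset n → Set
  MaximumIndependentIn S I =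
    IndependentIn S I × (∀ J → IndependentIn S J → ∣ J ∣ ≤ ∣ I ∣)

  coreIn : VSet n → VSet n
  coreIn S v = ∀ I → MaximumIndependentIn S I → v ∈ I

  coronaIn : VSet n → VSet n
  coronaIn S v = ∃ λ I → MaximumIndependentIn S I × v ∈ I

  AllV : VSet n
  AllV _ = ⊤

  core : VSet n
  core = coreIn AllV

  corona : VSet n
  corona = coronaIn AllV

  defect : Subset n → ℤ
  defect I = + ∣ I ∣ - + ∣ N I ∣

  Critical : Subset n → Set
  Critical I = Independent I × (∀ J → Independent J → defect J ≤ℤ defect I)

  MaximumCritical : Subset n → Set
  MaximumCritical I = Critical I × (∀ J → Critical J → ∣ J ∣ ≤ ∣ I ∣)

  nucleus : VSet n
  nucleus v = ∀ I → MaximumCritical I → v ∈ I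

  diadem : VSet n
  diadem v = ∃ λ I → Critical I × v ∈ I

  -- L(G) = J ∪ N(J) for a (any) maximum critical independent set J
  L : VSet n
  L v = ∃ λ J → MaximumCritical J × (v ∈ J ⊎ v ∈ N J)

  Lᶜ : VSet n
  Lᶜ v = ¬ L v

  -- core(L_G^c) = core(G[Lᶜ(G)])
  coreLᶜ : VSet n
  coreLᶜ = coreIn Lᶜ

module Submission where

-- Fix a maximum critical independent set J. Every critical set I satisfies I ∪ N(I) ⊆ J ∪ N(J),
-- so L(G) = J ∪ N(J). Every maximum independent set of G meets L(G) in |J| vertices and L_G^c in a
-- maximum independent set of L_G^c, and J′ ∪ T′ is maximum independent for every maximum critical J′
-- and every maximum independent set T′ of L_G^c; hence core ⊆ nucleus is equivalent to
-- core(L_G^c) = ∅.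
--
-- The inclusion diadem ⊆ corona ∩ L always holds, and nucleus ⊆ core is equivalent to
-- corona ∩ L ⊆ diadem. Given the latter, for a maximum independent S the set S ∩ L(G) has its
-- neighbourhood inside L(G), so it is maximum critical and contains the nucleus. Conversely, a
-- critical J satisfies Hall's condition |A| ≤ |J ∩ N(A)| for A ⊆ N(J); the sets attaining equality
-- are closed under union, so a largest such subset D of the diadem contains I ∩ N(J) for every
-- critical I, and if nucleus ⊆ core, counting through Hall's condition gives S ∩ N(J) ⊆ D.

open import Data.Bool using (true; false)
open import Data.Bool.Properties using (¬-not; T-≡) renaming (_≟_ to _≟ᵇ_)
open import Data.Empty using (⊥-elim)
open import Data.Fin using (Fin)
open import Data.Fin.Properties using (all?)
open import Data.Fin.Subset hiding (_-_) renaming (⊥ to ∅)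
open import Data.Fin.Subset.Properties
import Data.Integer as ℤ
import Data.Integer.Properties as ℤₚ
import Data.Integer.Tactic.RingSolver as ℤ-Solver
open import Data.List using ([]; _∷_)
open import Data.Nat using (ℕ; zero; suc; _+_; _≤_; z≤n; _≤?_)
open import Data.Nat.Properties
open import Algebra.Properties.CommutativeSemigroup +-commutativeSemigroup using (xy∙z≈yz∙x)
open import Data.Nat.Tactic.RingSolver using (solve)
open import Data.Product using (∃; ∃-syntax; _×_; _,_; proj₁; proj₂; uncurry)
open import Data.Sum using (inj₁; inj₂; [_,_]′)
open import Data.Unit using (tt)
open import Data.Vec.Properties using (lookup∘tabulate; []=⇒lookup; lookup⇒[]=)
open import Defs hiding (sym)
open import Function using (_∘_; id)
open import Function.Bundles using (_⇔_; mk⇔; Equivalence)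
open import Relation.Binary.PropositionalEquality
  using (_≡_; refl; sym; trans; cong; cong₂; subst; subst₂; module ≡-Reasoning)
open import Relation.Nullary using (¬_; Dec; yes; no)
open import Relation.Nullary.Decidable
  using (_×-dec_; _→-dec_; ¬?; map′; decidable-stable; toWitness; fromWitness)
open import Relation.Unary using (Decidable)

open Equivalence using (to; from)

private variable
  n : ℕ
  x : Fin n
  p q r s : Subset n

-- ℤ's +_ is opened only locally: elsewhere it would make sections such as (∣ p ∣ +_) ambiguous.
module _ where
  open ℤ using (+_; _-_)

  m-n≤o-p⇔m+p≤o+n : ∀ m n o p → (+ m - + n ℤ.≤ + o - + p) ⇔ (m + p ≤ o + n)
  m-n≤o-p⇔m+p≤o+n m n o p = mk⇔
    (λ le → ℤₚ.drop‿+≤+ (subst₂ ℤ._≤_ (shift (+ m) (+ n) (+ p)) (shift′ (+ o) (+ p) (+ n))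
                                     (ℤₚ.+-monoˡ-≤ (+ n ℤ.+ + p) le)))
    (λ le → subst₂ ℤ._≤_ (unshift (+ m) (+ p) (+ n)) (unshift′ (+ o) (+ n) (+ p))
                         (ℤₚ.+-monoˡ-≤ (ℤ.- (+ n ℤ.+ + p)) (ℤ.+≤+ le)))
    where
    shift : ∀ a b c → a - b ℤ.+ (b ℤ.+ c) ≡ a ℤ.+ c
    shift = ℤ-Solver.solve-∀
    shift′ : ∀ a c b → a - c ℤ.+ (b ℤ.+ c) ≡ a ℤ.+ b
    shift′ = ℤ-Solver.solve-∀
    unshift : ∀ a c b → a ℤ.+ c ℤ.+ ℤ.- (b ℤ.+ c) ≡ a - b
    unshift = ℤ-Solver.solve-∀
    unshift′ : ∀ a b c → a ℤ.+ b ℤ.+ ℤ.- (b ℤ.+ c) ≡ a - c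
    unshift′ = ℤ-Solver.solve-∀

+-squeeze : ∀ {a b c d} → a ≤ c → b ≤ d → c + d ≤ a + b → a ≡ c × b ≡ d
+-squeeze {a} {b} {c} {d} a≤c b≤d c+d≤a+b =
  ≤-antisym a≤c (+-cancelʳ-≤ d c a (≤-trans c+d≤a+b (+-monoʳ-≤ a b≤d))) ,
  ≤-antisym b≤d (+-cancelˡ-≤ c d b (≤-trans c+d≤a+b (+-monoˡ-≤ b a≤c)))

-- Finite subsets

Disjoint : Subset n → Subset n → Set
Disjoint p q = ∀ {x} → x ∈ p → x ∉ q

∪-least : p ⊆ r → q ⊆ r → p ∪ q ⊆ r
∪-least {p = p} {q = q} p⊆r q⊆r x∈p∪q = [ p⊆r , q⊆r ]′ (x∈p∪q⁻ p q x∈p∪q)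

allSubsets? : {P : Subset n → Set} → Decidable P → Dec (∀ p → P p)
allSubsets? P? with anySubset? (¬? ∘ P?)
... | yes (p , ¬Pp) = no λ ∀P → ¬Pp (∀P p)
... | no  ∄¬P       = yes λ p → decidable-stable (P? p) λ ¬Pp → ∄¬P (p , ¬Pp)

-- Vec's _∷_ is opened only locally: elsewhere it would clash with List's _∷_ in solve's variable lists.
module _ where
  open import Data.Vec using ([]; _∷_; here; there)

  ∣p∪q∣+∣p∩q∣≡∣p∣+∣q∣ : ∀ (p q : Subset n) → ∣ p ∪ q ∣ + ∣ p ∩ q ∣ ≡ ∣ p ∣ + ∣ q ∣
  ∣p∪q∣+∣p∩q∣≡∣p∣+∣q∣ []            []            = refl
  ∣p∪q∣+∣p∩q∣≡∣p∣+∣q∣ (inside  ∷ p) (inside  ∷ q) =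
    cong suc (trans (+-suc _ _) (trans (cong suc (∣p∪q∣+∣p∩q∣≡∣p∣+∣q∣ p q)) (sym (+-suc _ _))))
  ∣p∪q∣+∣p∩q∣≡∣p∣+∣q∣ (inside  ∷ p) (outside ∷ q) = cong suc (∣p∪q∣+∣p∩q∣≡∣p∣+∣q∣ p q)
  ∣p∪q∣+∣p∩q∣≡∣p∣+∣q∣ (outside ∷ p) (inside  ∷ q) =
    trans (cong suc (∣p∪q∣+∣p∩q∣≡∣p∣+∣q∣ p q)) (sym (+-suc _ _))
  ∣p∪q∣+∣p∩q∣≡∣p∣+∣q∣ (outside ∷ p) (outside ∷ q) = ∣p∪q∣+∣p∩q∣≡∣p∣+∣q∣ p q

  ∣p∣≡∣p∩q∣+∣p─q∣ : ∀ (p q : Subset n) → ∣ p ∣ ≡ ∣ p ∩ q ∣ + ∣ p ─ q ∣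
  ∣p∣≡∣p∩q∣+∣p─q∣ []            []            = refl
  ∣p∣≡∣p∩q∣+∣p─q∣ (inside  ∷ p) (inside  ∷ q) = cong suc (∣p∣≡∣p∩q∣+∣p─q∣ p q)
  ∣p∣≡∣p∩q∣+∣p─q∣ (inside  ∷ p) (outside ∷ q) =
    trans (cong suc (∣p∣≡∣p∩q∣+∣p─q∣ p q)) (sym (+-suc _ _))
  ∣p∣≡∣p∩q∣+∣p─q∣ (outside ∷ p) (inside  ∷ q) = ∣p∣≡∣p∩q∣+∣p─q∣ p q
  ∣p∣≡∣p∩q∣+∣p─q∣ (outside ∷ p) (outside ∷ q) = ∣p∣≡∣p∩q∣+∣p─q∣ p q

  x∈p─q⇒x∉q : ∀ (p q : Subset n) → x ∈ p ─ q → x ∉ q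
  x∈p─q⇒x∉q (inside ∷ p) (outside ∷ q) here          ()
  x∈p─q⇒x∉q (_      ∷ p) (inside  ∷ q) (there x∈p─q) (there x∈q) = x∈p─q⇒x∉q p q x∈p─q x∈q
  x∈p─q⇒x∉q (_      ∷ p) (outside ∷ q) (there x∈p─q) (there x∈q) = x∈p─q⇒x∉q p q x∈p─q x∈q

∣p∣+∣∁p∣≡n : ∀ (p : Subset n) → ∣ p ∣ + ∣ ∁ p ∣ ≡ n
∣p∣+∣∁p∣≡n p = trans (cong (∣ p ∣ +_) (∣∁p∣≡n∸∣p∣ p)) (m+[n∸m]≡n (∣p∣≤n p))

∣p∪q∣≤∣p∣+∣q∣ : ∀ (p q : Subset n) → ∣ p ∪ q ∣ ≤ ∣ p ∣ + ∣ q ∣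
∣p∪q∣≤∣p∣+∣q∣ p q = subst (∣ p ∪ q ∣ ≤_) (∣p∪q∣+∣p∩q∣≡∣p∣+∣q∣ p q) (m≤m+n _ _)

Disjoint⇒∣p∪q∣≡∣p∣+∣q∣ : ∀ (p q : Subset n) → Disjoint p q → ∣ p ∪ q ∣ ≡ ∣ p ∣ + ∣ q ∣
Disjoint⇒∣p∪q∣≡∣p∣+∣q∣ {n = n} p q p∩q=∅ = begin
  ∣ p ∪ q ∣               ≡⟨ sym (+-identityʳ _) ⟩
  ∣ p ∪ q ∣ + 0           ≡⟨ cong (∣ p ∪ q ∣ +_) (sym ∣p∩q∣≡0) ⟩
  ∣ p ∪ q ∣ + ∣ p ∩ q ∣   ≡⟨ ∣p∪q∣+∣p∩q∣≡∣p∣+∣q∣ p q ⟩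
  ∣ p ∣ + ∣ q ∣           ∎
  where
  open ≡-Reasoning
  ∣p∩q∣≡0 : ∣ p ∩ q ∣ ≡ 0
  ∣p∩q∣≡0 = trans (cong ∣_∣ (Empty-unique λ (_ , x∈p∩q) → uncurry p∩q=∅ (x∈p∩q⁻ p q x∈p∩q)))
                  (∣⊥∣≡0 n)

Disjoint⇒∣p∣+∣q∣≤∣r∣ : Disjoint p q → p ⊆ r → q ⊆ r → ∣ p ∣ + ∣ q ∣ ≤ ∣ r ∣
Disjoint⇒∣p∣+∣q∣≤∣r∣ {p = p} {q = q} p∩q=∅ p⊆r q⊆r =
  subst (_≤ _) (Disjoint⇒∣p∪q∣≡∣p∣+∣q∣ p q p∩q=∅) (p⊆q⇒∣p∣≤∣q∣ (∪-least p⊆r q⊆r))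

p⊆r∪s∧q⊆r∩s⇒∣p∣+∣q∣≤∣r∣+∣s∣ : p ⊆ r ∪ s → q ⊆ r ∩ s → ∣ p ∣ + ∣ q ∣ ≤ ∣ r ∣ + ∣ s ∣
p⊆r∪s∧q⊆r∩s⇒∣p∣+∣q∣≤∣r∣+∣s∣ {p = p} {r = r} {s = s} {q = q} p⊆r∪s q⊆r∩s =
  subst (∣ p ∣ + ∣ q ∣ ≤_) (∣p∪q∣+∣p∩q∣≡∣p∣+∣q∣ r s) (+-mono-≤ (p⊆q⇒∣p∣≤∣q∣ p⊆r∪s) (p⊆q⇒∣p∣≤∣q∣ q⊆r∩s))

p⊆q∧∣q∣≤∣p∣⇒q⊆p : p ⊆ q → ∣ q ∣ ≤ ∣ p ∣ → q ⊆ p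
p⊆q∧∣q∣≤∣p∣⇒q⊆p {p = p} p⊆q ∣q∣≤∣p∣ {x} x∈q with x ∈? p
... | yes x∈p = x∈p
... | no  x∉p = ⊥-elim (<⇒≱ (p⊂q⇒∣p∣<∣q∣ (p⊆q , x , x∈q , x∉p)) ∣q∣≤∣p∣)

Maximises : (Subset n → Set) → (Subset n → ℕ) → Subset n → Set
Maximises P f X = P X × (∀ Y → P Y → f Y ≤ f X)

maximiser-exists : {P : Subset n → Set} → Decidable P → (f : Subset n → ℕ) (b : ℕ) →
                   (∀ X → P X → f X ≤ b) → ∃ P → ∃ (Maximises P f)
maximiser-exists P? f b f≤b (X₀ , PX₀) with anySubset? (λ X → P? X ×-dec (b ≤? f X))
... | yes (X , PX , b≤fX) = X , PX , λ Y PY → ≤-trans (f≤b Y PY) b≤fX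
maximiser-exists P? f zero    f≤b (X₀ , PX₀) | no ∄ = ⊥-elim (∄ (X₀ , PX₀ , z≤n))
maximiser-exists P? f (suc b) f≤b (X₀ , PX₀) | no ∄ =
  maximiser-exists P? f b (λ Y PY → ≤-pred (≰⇒> λ b<fY → ∄ (Y , PY , b<fY))) (X₀ , PX₀)

module _ {n : ℕ} (G : Graph n) where

  private variable
    u v : Fin n
    A B I J K S X Y : Subset n

  -- Neighbourhoods and independent sets

  ∈N⁻ : v ∈ N G X → ∃[ u ] u ∈ X × adj G u v ≡ true
  ∈N⁻ {v} v∈NX = toWitness (from T-≡ (trans (sym (lookup∘tabulate _ v)) ([]=⇒lookup v∈NX)))

  ∈N⁺ : u ∈ X → adj G u v ≡ true → v ∈ N G X
  ∈N⁺ {X = X} {v} u∈X uv =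
    lookup⇒[]= v (N G X) (trans (lookup∘tabulate _ v) (to T-≡ (fromWitness (_ , u∈X , uv))))

  ∈N⁺′ : u ∈ X → adj G v u ≡ true → v ∈ N G X
  ∈N⁺′ {u} {v = v} u∈X vu = ∈N⁺ u∈X (trans (Graph.sym G u v) vu)

  N-mono : A ⊆ B → N G A ⊆ N G B
  N-mono A⊆B v∈NA with ∈N⁻ v∈NA
  ... | u , u∈A , uv = ∈N⁺ (A⊆B u∈A) uv

  N-∅ : N G ∅ ⊆ ∅
  N-∅ v∈N∅ with ∈N⁻ v∈N∅
  ... | u , u∈∅ , _ = ⊥-elim (∉⊥ u∈∅)

  N-∪ : N G (A ∪ B) ⊆ N G A ∪ N G B
  N-∪ {A} {B} v∈N⟨A∪B⟩ with ∈N⁻ v∈N⟨A∪B⟩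
  ... | u , u∈A∪B , uv =
    x∈p∪q⁺ ([ (λ u∈A → inj₁ (∈N⁺ u∈A uv)) , (λ u∈B → inj₂ (∈N⁺ u∈B uv)) ]′ (x∈p∪q⁻ A B u∈A∪B))

  N-∩ : N G (A ∩ B) ⊆ N G A ∩ N G B
  N-∩ {A} {B} v∈N⟨A∩B⟩ = x∈p∩q⁺ (N-mono (p∩q⊆p A B) v∈N⟨A∩B⟩ , N-mono (p∩q⊆q A B) v∈N⟨A∩B⟩)

  ∣N⟨A∪B⟩∣+∣N⟨A∩B⟩∣≤∣NA∣+∣NB∣ : ∀ A B → ∣ N G (A ∪ B) ∣ + ∣ N G (A ∩ B) ∣ ≤ ∣ N G A ∣ + ∣ N G B ∣
  ∣N⟨A∪B⟩∣+∣N⟨A∩B⟩∣≤∣NA∣+∣NB∣ A B = p⊆r∪s∧q⊆r∩s⇒∣p∣+∣q∣≤∣r∣+∣s∣ N-∪ N-∩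

  N[_] : Subset n → Subset n
  N[ X ] = X ∪ N G X

  Independent? : Decidable (Independent G)
  Independent? I = all? λ u → all? λ v → (u ∈? I) →-dec (v ∈? I) →-dec (adj G u v ≟ᵇ false)

  IndependentIn? : {S : VSet n} → Decidable S → Decidable (IndependentIn G S)
  IndependentIn? S? I = all? (λ v → (v ∈? I) →-dec S? v) ×-dec Independent? I

  ∅-independent : Independent G ∅
  ∅-independent u _ u∈∅ = ⊥-elim (∉⊥ u∈∅)

  independent-⊆ : Independent G I → J ⊆ I → Independent G J
  independent-⊆ I-ind J⊆I u v u∈J v∈J = I-ind u v (J⊆I u∈J) (J⊆I v∈J)

  independent⇒Disjoint-N : Independent G I → Disjoint I (N G I)
  independent⇒Disjoint-N I-ind {v} v∈I v∈NI with ∈N⁻ v∈NI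
  ... | u , u∈I , uv with () ← trans (sym uv) (I-ind u v u∈I v∈I)

  independent-∪ : Independent G A → Independent G B → Disjoint B (N G A) → Independent G (A ∪ B)
  independent-∪ {A} {B} A-ind B-ind B∩NA=∅ u v u∈A∪B v∈A∪B with x∈p∪q⁻ A B u∈A∪B | x∈p∪q⁻ A B v∈A∪B
  ... | inj₁ u∈A | inj₁ v∈A = A-ind u v u∈A v∈A
  ... | inj₂ u∈B | inj₂ v∈B = B-ind u v u∈B v∈B
  ... | inj₁ u∈A | inj₂ v∈B = ¬-not λ uv → B∩NA=∅ v∈B (∈N⁺ u∈A uv)
  ... | inj₂ u∈B | inj₁ v∈A = ¬-not λ uv → B∩NA=∅ u∈B (∈N⁺′ v∈A uv)

  MaximumIndependent : Subset n → Set
  MaximumIndependent = MaximumIndependentIn G (AllV G)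

  maximumIndependentIn-exists : {S : VSet n} → Decidable S → ∃ (MaximumIndependentIn G S)
  maximumIndependentIn-exists S? = maximiser-exists (IndependentIn? S?) ∣_∣ n (λ X _ → ∣p∣≤n X)
    (∅ , (λ _ v∈∅ → ⊥-elim (∉⊥ v∈∅)) , ∅-independent)

  -- Critical independent sets

  Critical? : Decidable (Critical G)
  Critical? I = Independent? I ×-dec allSubsets? λ K → Independent? K →-dec (defect G K ℤ.≤? defect G I)

  diadem? : Decidable (diadem G)
  diadem? v = anySubset? λ I → Critical? I ×-dec (v ∈? I)

  defect≤⇔ : ∀ K I → defect G K ℤ.≤ defect G I ⇔ ∣ K ∣ + ∣ N G I ∣ ≤ ∣ I ∣ + ∣ N G K ∣
  defect≤⇔ K I = m-n≤o-p⇔m+p≤o+n (∣ K ∣) (∣ N G K ∣) (∣ I ∣) (∣ N G I ∣)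

  critical⇒defect-bound : Critical G I → Independent G K → ∣ K ∣ + ∣ N G I ∣ ≤ ∣ I ∣ + ∣ N G K ∣
  critical⇒defect-bound {I} {K} (_ , I-max) K-ind = to (defect≤⇔ K I) (I-max K K-ind)

  defect≥critical⇒critical : Critical G J → Independent G K →
                             ∣ J ∣ + ∣ N G K ∣ ≤ ∣ K ∣ + ∣ N G J ∣ → Critical G K
  defect≥critical⇒critical {J} {K} (_ , J-max) K-ind dJ≤dK =
    K-ind , λ Y Y-ind → ℤₚ.≤-trans (J-max Y Y-ind) (from (defect≤⇔ J K) dJ≤dK)

  -- |X| + |∁ N(X)| is the defect of X shifted by n, so it can be maximised within ℕ.
  critical-exists : ∃ (Critical G)
  critical-exists = maximiser⇒critical (maximiser-exists Independent? shiftedDefect (n + n)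
                      (λ X _ → +-mono-≤ (∣p∣≤n X) (∣p∣≤n (∁ (N G X)))) (∅ , ∅-independent))
    where
    shiftedDefect : Subset n → ℕ
    shiftedDefect X = ∣ X ∣ + ∣ ∁ (N G X) ∣

    arithmetic : ∀ x nx cx y ny cy → y + cy ≤ x + cx → nx + cx ≡ n → ny + cy ≡ n → y + nx ≤ x + ny
    arithmetic x nx cx y ny cy maximal eX eY = +-cancelʳ-≤ (cx + cy) _ _ (begin
      y + nx + (cx + cy)   ≡⟨ solve (y ∷ nx ∷ cx ∷ cy ∷ []) ⟩
      y + cy + (nx + cx)   ≡⟨ cong (y + cy +_) eX ⟩
      y + cy + n           ≤⟨ +-monoˡ-≤ n maximal ⟩
      x + cx + n           ≡⟨ cong (x + cx +_) (sym eY) ⟩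
      x + cx + (ny + cy)   ≡⟨ solve (x ∷ cx ∷ ny ∷ cy ∷ []) ⟩
      x + ny + (cx + cy)   ∎)
      where open ≤-Reasoning

    maximiser⇒critical : ∃ (Maximises (Independent G) shiftedDefect) → ∃ (Critical G)
    maximiser⇒critical (X , X-ind , X-max) = X , X-ind , λ Y Y-ind → from (defect≤⇔ Y X)
      (arithmetic (∣ X ∣) (∣ N G X ∣) (∣ ∁ (N G X) ∣) (∣ Y ∣) (∣ N G Y ∣) (∣ ∁ (N G Y) ∣)
                  (X-max Y Y-ind) (∣p∣+∣∁p∣≡n (N G X)) (∣p∣+∣∁p∣≡n (N G Y)))

  maximumCritical-exists : ∃ (MaximumCritical G)
  maximumCritical-exists = maximiser-exists Critical? ∣_∣ n (λ X _ → ∣p∣≤n X) critical-exists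

  critical⇒∣S∣≤∣J∩NS∣ : Critical G J → S ⊆ N G J → ∣ S ∣ ≤ ∣ J ∩ N G S ∣
  critical⇒∣S∣≤∣J∩NS∣ {J} {S} J-crit S⊆NJ =
    arithmetic (∣ J′ ∣) (∣ N G J′ ∣) (∣ S ∣) (∣ J ∣) (∣ J ∩ N G S ∣) (∣ N G J ∣)
      (critical⇒defect-bound J-crit J′-ind) (∣p∣≡∣p∩q∣+∣p─q∣ J (N G S)) ∣NJ′∣+∣S∣≤∣NJ∣
    where
    J′ : Subset n
    J′ = J ─ N G S

    J′-ind : Independent G J′
    J′-ind = independent-⊆ (proj₁ J-crit) (p─q⊆p J (N G S))

    NJ′∩S=∅ : Disjoint (N G J′) S
    NJ′∩S=∅ v∈NJ′ v∈S with ∈N⁻ v∈NJ′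
    ... | u , u∈J′ , uv = x∈p─q⇒x∉q J (N G S) u∈J′ (∈N⁺′ v∈S uv)

    ∣NJ′∣+∣S∣≤∣NJ∣ : ∣ N G J′ ∣ + ∣ S ∣ ≤ ∣ N G J ∣
    ∣NJ′∣+∣S∣≤∣NJ∣ = Disjoint⇒∣p∣+∣q∣≤∣r∣ NJ′∩S=∅ (N-mono (p─q⊆p J (N G S))) S⊆NJ

    arithmetic : ∀ k nk s j js nj → k + nj ≤ j + nk → j ≡ js + k → nk + s ≤ nj → s ≤ js
    arithmetic k nk s j js nj critical split disjoint = +-cancelˡ-≤ (k + nk) s js (begin
      k + nk + s     ≡⟨ +-assoc k nk s ⟩
      k + (nk + s)   ≤⟨ +-monoʳ-≤ k disjoint ⟩
      k + nj         ≤⟨ critical ⟩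
      j + nk         ≡⟨ cong (_+ nk) split ⟩
      js + k + nk    ≡⟨ solve (js ∷ k ∷ nk ∷ []) ⟩
      k + nk + js    ∎)
      where open ≤-Reasoning

  critical⇒∣K∩N[J]∣≤∣J∣ : Critical G J → Independent G K → ∣ K ∩ N[ J ] ∣ ≤ ∣ J ∣
  critical⇒∣K∩N[J]∣≤∣J∣ {J} {K} J-crit K-ind = begin
    ∣ K′ ∣                                     ≡⟨ ∣p∣≡∣p∩q∣+∣p─q∣ K′ (N G J) ⟩
    ∣ K′ ∩ N G J ∣ + ∣ K′ ─ N G J ∣             ≤⟨ +-monoˡ-≤ _ (critical⇒∣S∣≤∣J∩NS∣ J-crit
                                                                  (p∩q⊆q K′ (N G J))) ⟩
    ∣ J ∩ N G (K′ ∩ N G J) ∣ + ∣ K′ ─ N G J ∣   ≤⟨ Disjoint⇒∣p∣+∣q∣≤∣r∣ disjoint (p∩q⊆p J _) K′─NJ⊆J ⟩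
    ∣ J ∣                                      ∎
    where
    open ≤-Reasoning
    K′ : Subset n
    K′ = K ∩ N[ J ]

    K′─NJ⊆J : K′ ─ N G J ⊆ J
    K′─NJ⊆J {x} x∈K′─NJ with x∈p∪q⁻ J (N G J) (p∩q⊆q K N[ J ] (p─q⊆p K′ (N G J) x∈K′─NJ))
    ... | inj₁ x∈J  = x∈J
    ... | inj₂ x∈NJ = ⊥-elim (x∈p─q⇒x∉q K′ (N G J) x∈K′─NJ x∈NJ)

    disjoint : Disjoint (J ∩ N G (K′ ∩ N G J)) (K′ ─ N G J)
    disjoint x∈J∩N x∈K′─NJ = independent⇒Disjoint-N K-ind
      (p∩q⊆p K N[ J ] (p─q⊆p K′ (N G J) x∈K′─NJ))
      (N-mono (p∩q⊆p K N[ J ] ∘ p∩q⊆p K′ (N G J)) (p∩q⊆q J _ x∈J∩N))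

  critical⊆maximumIndependent : Critical G I → ∃[ S ] MaximumIndependent S × I ⊆ S
  critical⊆maximumIndependent {I} I-crit with maximumIndependentIn-exists {AllV G} (λ _ → yes tt)
  ... | S , (_ , S-ind) , S-max =
    S′ , (((λ _ _ → tt) , S′-ind) , λ Y Y-ind → ≤-trans (S-max Y Y-ind) ∣S∣≤∣S′∣) , p⊆p∪q _
    where
    S′ : Subset n
    S′ = I ∪ (S ─ N[ I ])

    S─N[I]∩N[I]=∅ : Disjoint (S ─ N[ I ]) N[ I ]
    S─N[I]∩N[I]=∅ = x∈p─q⇒x∉q S N[ I ]

    S′-ind : Independent G S′
    S′-ind = independent-∪ (proj₁ I-crit) (independent-⊆ S-ind (p─q⊆p S N[ I ]))
               (λ x∈S─N[I] x∈NI → S─N[I]∩N[I]=∅ x∈S─N[I] (q⊆p∪q I (N G I) x∈NI))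

    ∣S∣≤∣S′∣ : ∣ S ∣ ≤ ∣ S′ ∣
    ∣S∣≤∣S′∣ = begin
      ∣ S ∣                              ≡⟨ ∣p∣≡∣p∩q∣+∣p─q∣ S N[ I ] ⟩
      ∣ S ∩ N[ I ] ∣ + ∣ S ─ N[ I ] ∣     ≤⟨ +-monoˡ-≤ _ (critical⇒∣K∩N[J]∣≤∣J∣ I-crit S-ind) ⟩
      ∣ I ∣ + ∣ S ─ N[ I ] ∣              ≡⟨ sym (Disjoint⇒∣p∪q∣≡∣p∣+∣q∣ I (S ─ N[ I ])
                                             λ x∈I x∈S─N[I] → S─N[I]∩N[I]=∅ x∈S─N[I] (p⊆p∪q _ x∈I)) ⟩
      ∣ S′ ∣                             ∎
      where open ≤-Reasoning

  critical⇒∣N⟨I∪X⟩∣+∣X∣≤∣I∪X∣+∣NX∣ : Critical G I → ∀ X → ∣ N G (I ∪ X) ∣ + ∣ X ∣ ≤ ∣ I ∪ X ∣ + ∣ N G X ∣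
  critical⇒∣N⟨I∪X⟩∣+∣X∣≤∣I∪X∣+∣NX∣ {I} I-crit X =
    arithmetic (∣ N G (I ∪ X) ∣) (∣ N G (I ∩ X) ∣) (∣ N G I ∣) (∣ N G X ∣)
               (∣ I ∩ X ∣) (∣ I ∣) (∣ X ∣) (∣ I ∪ X ∣)
      (∣N⟨A∪B⟩∣+∣N⟨A∩B⟩∣≤∣NA∣+∣NB∣ I X)
      (critical⇒defect-bound I-crit (independent-⊆ (proj₁ I-crit) (p∩q⊆p I X)))
      (∣p∪q∣+∣p∩q∣≡∣p∣+∣q∣ I X)
    where
    arithmetic : ∀ a b ni nx c i x u → a + b ≤ ni + nx → c + ni ≤ i + b → u + c ≡ i + x → a + x ≤ u + nx
    arithmetic a b ni nx c i x u supermodular critical inclusion-exclusion =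
      +-cancelʳ-≤ (b + c + ni) _ _ (begin
        a + x + (b + c + ni)        ≡⟨ solve (a ∷ x ∷ b ∷ c ∷ ni ∷ []) ⟩
        (a + b) + (c + ni) + x      ≤⟨ +-monoˡ-≤ x (+-mono-≤ supermodular critical) ⟩
        (ni + nx) + (i + b) + x     ≡⟨ solve (ni ∷ nx ∷ i ∷ b ∷ x ∷ []) ⟩
        nx + b + ni + (i + x)       ≡⟨ cong (nx + b + ni +_) (sym inclusion-exclusion) ⟩
        nx + b + ni + (u + c)       ≡⟨ solve (nx ∷ b ∷ ni ∷ u ∷ c ∷ []) ⟩
        u + nx + (b + c + ni)       ∎)
      where open ≤-Reasoning

  critical⇒J∪[I─N[J]]-critical : Critical G J → Critical G I → Critical G (J ∪ (I ─ N[ J ]))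
  critical⇒J∪[I─N[J]]-critical {J} {I} J-crit I-crit = defect≥critical⇒critical J-crit Z-ind
    (arithmetic (∣ N G Z ∣) (∣ J ∩ N G I″ ∣) (∣ N G (I ∪ J) ∣) (∣ J ∣) (∣ I ∪ J ∣) (∣ N G J ∣)
                (∣ I′ ∣) (∣ I″ ∣) (∣ Z ∣)
      ∣NZ∣+∣J∩NI″∣≤∣N⟨I∪J⟩∣ (critical⇒∣N⟨I∪X⟩∣+∣X∣≤∣I∪X∣+∣NX∣ I-crit J) ∣I∪J∣≤∣J∣+∣I′∣+∣I″∣
      (critical⇒∣S∣≤∣J∩NS∣ J-crit (p∩q⊆q I (N G J))) (Disjoint⇒∣p∪q∣≡∣p∣+∣q∣ J I′ J∩I′=∅))
    where
    I′ I″ Z : Subset n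
    I′ = I ─ N[ J ]
    I″ = I ∩ N G J
    Z  = J ∪ I′

    I′∩N[J]=∅ : Disjoint I′ N[ J ]
    I′∩N[J]=∅ = x∈p─q⇒x∉q I N[ J ]

    J∩I′=∅ : Disjoint J I′
    J∩I′=∅ x∈J x∈I′ = I′∩N[J]=∅ x∈I′ (p⊆p∪q _ x∈J)

    Z-ind : Independent G Z
    Z-ind = independent-∪ (proj₁ J-crit) (independent-⊆ (proj₁ I-crit) (p─q⊆p I N[ J ]))
              (λ x∈I′ x∈NJ → I′∩N[J]=∅ x∈I′ (q⊆p∪q J (N G J) x∈NJ))

    NZ∩J∩NI″=∅ : Disjoint (N G Z) (J ∩ N G I″)
    NZ∩J∩NI″=∅ {w} w∈NZ w∈J∩NI″ with ∈N⁻ w∈NZ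
    ... | u , u∈Z , uw with x∈p∪q⁻ J I′ u∈Z
    ...   | inj₁ u∈J  = independent⇒Disjoint-N (proj₁ J-crit) (p∩q⊆p J _ w∈J∩NI″) (∈N⁺ u∈J uw)
    ...   | inj₂ u∈I′ = I′∩N[J]=∅ u∈I′ (q⊆p∪q J (N G J) (∈N⁺′ (p∩q⊆p J _ w∈J∩NI″) uw))

    ∣NZ∣+∣J∩NI″∣≤∣N⟨I∪J⟩∣ : ∣ N G Z ∣ + ∣ J ∩ N G I″ ∣ ≤ ∣ N G (I ∪ J) ∣
    ∣NZ∣+∣J∩NI″∣≤∣N⟨I∪J⟩∣ = Disjoint⇒∣p∣+∣q∣≤∣r∣ NZ∩J∩NI″=∅
      (N-mono (∪-least (q⊆p∪q I J) (p⊆p∪q J ∘ p─q⊆p I N[ J ])))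
      (N-mono (p⊆p∪q J ∘ p∩q⊆p I (N G J)) ∘ p∩q⊆q J (N G I″))

    I∪J⊆J∪I′∪I″ : I ∪ J ⊆ J ∪ (I′ ∪ I″)
    I∪J⊆J∪I′∪I″ {x} x∈I∪J with x∈p∪q⁻ I J x∈I∪J
    ... | inj₂ x∈J = p⊆p∪q _ x∈J
    ... | inj₁ x∈I with x ∈? N[ J ]
    ...   | no  x∉N[J] = q⊆p∪q J _ (p⊆p∪q I″ (x∈p∧x∉q⇒x∈p─q x∈I x∉N[J]))
    ...   | yes x∈N[J] = [ p⊆p∪q _ , (λ x∈NJ → q⊆p∪q J _ (q⊆p∪q I′ I″ (x∈p∩q⁺ (x∈I , x∈NJ)))) ]′
                           (x∈p∪q⁻ J (N G J) x∈N[J])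

    ∣I∪J∣≤∣J∣+∣I′∣+∣I″∣ : ∣ I ∪ J ∣ ≤ ∣ J ∣ + (∣ I′ ∣ + ∣ I″ ∣)
    ∣I∪J∣≤∣J∣+∣I′∣+∣I″∣ = ≤-trans (p⊆q⇒∣p∣≤∣q∣ I∪J⊆J∪I′∪I″)
      (≤-trans (∣p∪q∣≤∣p∣+∣q∣ J (I′ ∪ I″)) (+-monoʳ-≤ ∣ J ∣ (∣p∪q∣≤∣p∣+∣q∣ I′ I″)))

    arithmetic : ∀ nz h nx j x nj i′ i″ z → nz + h ≤ nx → nx + j ≤ x + nj → x ≤ j + (i′ + i″) →
                 i″ ≤ h → z ≡ j + i′ → j + nz ≤ z + nj
    arithmetic nz h nx j x nj i′ i″ z disjoint union cover hall refl = +-cancelʳ-≤ h _ _ (begin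
      j + nz + h             ≡⟨ solve (j ∷ nz ∷ h ∷ []) ⟩
      nz + h + j             ≤⟨ +-monoˡ-≤ j disjoint ⟩
      nx + j                 ≤⟨ union ⟩
      x + nj                 ≤⟨ +-monoˡ-≤ nj (≤-trans cover (+-monoʳ-≤ j (+-monoʳ-≤ i′ hall))) ⟩
      j + (i′ + h) + nj      ≡⟨ solve (j ∷ i′ ∷ h ∷ nj ∷ []) ⟩
      j + i′ + nj + h        ∎)
      where open ≤-Reasoning

  maximumCritical⇒critical⊆N[J] : MaximumCritical G J → Critical G I → I ⊆ N[ J ]
  maximumCritical⇒critical⊆N[J] {J} {I} (J-crit , J-max) I-crit {x} x∈I with x ∈? N[ J ]
  ... | yes x∈N[J] = x∈N[J]
  ... | no  x∉N[J] = ⊥-elim (x∉N[J] (p⊆p∪q (N G J) (Z⊆J (q⊆p∪q J _ (x∈p∧x∉q⇒x∈p─q x∈I x∉N[J])))))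
    where
    Z⊆J : J ∪ (I ─ N[ J ]) ⊆ J
    Z⊆J = p⊆q∧∣q∣≤∣p∣⇒q⊆p (p⊆p∪q _) (J-max _ (critical⇒J∪[I─N[J]]-critical J-crit I-crit))

  ∣N⟨I∪J⟩∣≤∣I∩NJ∣+∣NJ∣ : MaximumCritical G J → Critical G I → ∣ N G (I ∪ J) ∣ ≤ ∣ I ∩ N G J ∣ + ∣ N G J ∣
  ∣N⟨I∪J⟩∣≤∣I∩NJ∣+∣NJ∣ {J} {I} J-max I-crit = +-cancelʳ-≤ ∣ J ∣ _ _ (begin
    ∣ N G (I ∪ J) ∣ + ∣ J ∣     ≤⟨ critical⇒∣N⟨I∪X⟩∣+∣X∣≤∣I∪X∣+∣NX∣ I-crit J ⟩
    ∣ I ∪ J ∣ + ∣ N G J ∣       ≤⟨ +-monoˡ-≤ _ (≤-trans (p⊆q⇒∣p∣≤∣q∣ I∪J⊆J∪I″) (∣p∪q∣≤∣p∣+∣q∣ J I″)) ⟩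
    ∣ J ∣ + ∣ I″ ∣ + ∣ N G J ∣   ≡⟨ xy∙z≈yz∙x (∣ J ∣) (∣ I″ ∣) (∣ N G J ∣) ⟩
    ∣ I″ ∣ + ∣ N G J ∣ + ∣ J ∣   ∎)
    where
    open ≤-Reasoning
    I″ : Subset n
    I″ = I ∩ N G J

    I∪J⊆J∪I″ : I ∪ J ⊆ J ∪ I″
    I∪J⊆J∪I″ x∈I∪J with x∈p∪q⁻ I J x∈I∪J
    ... | inj₂ x∈J = p⊆p∪q _ x∈J
    ... | inj₁ x∈I = [ p⊆p∪q _ , (λ x∈NJ → q⊆p∪q J I″ (x∈p∩q⁺ (x∈I , x∈NJ))) ]′
                       (x∈p∪q⁻ J (N G J) (maximumCritical⇒critical⊆N[J] J-max I-crit x∈I))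

  maximumCritical⇒N⟨critical⟩⊆N[J] : MaximumCritical G J → Critical G I → N G I ⊆ N[ J ]
  maximumCritical⇒N⟨critical⟩⊆N[J] {J} {I} J-max I-crit =
    ∪-least (q⊆p∪q J (N G J)) (p⊆p∪q (N G J) ∘ p∩q⊆p J (N G I″)) ∘ N⟨I∪J⟩⊆W ∘ N-mono (p⊆p∪q J)
    where
    open ≤-Reasoning
    I″ W : Subset n
    I″ = I ∩ N G J
    W  = N G J ∪ (J ∩ N G I″)

    W⊆N⟨I∪J⟩ : W ⊆ N G (I ∪ J)
    W⊆N⟨I∪J⟩ = ∪-least (N-mono (q⊆p∪q I J)) (N-mono (p⊆p∪q J ∘ p∩q⊆p I (N G J)) ∘ p∩q⊆q J (N G I″))

    ∣W∣≡∣NJ∣+∣J∩NI″∣ : ∣ W ∣ ≡ ∣ N G J ∣ + ∣ J ∩ N G I″ ∣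
    ∣W∣≡∣NJ∣+∣J∩NI″∣ = Disjoint⇒∣p∪q∣≡∣p∣+∣q∣ (N G J) (J ∩ N G I″)
      λ x∈NJ x∈J∩NI″ → independent⇒Disjoint-N (proj₁ (proj₁ J-max)) (p∩q⊆p J _ x∈J∩NI″) x∈NJ

    N⟨I∪J⟩⊆W : N G (I ∪ J) ⊆ W
    N⟨I∪J⟩⊆W = p⊆q∧∣q∣≤∣p∣⇒q⊆p W⊆N⟨I∪J⟩ (begin
      ∣ N G (I ∪ J) ∣             ≤⟨ ∣N⟨I∪J⟩∣≤∣I∩NJ∣+∣NJ∣ J-max I-crit ⟩
      ∣ I″ ∣ + ∣ N G J ∣           ≤⟨ +-monoˡ-≤ _ (critical⇒∣S∣≤∣J∩NS∣ (proj₁ J-max) (p∩q⊆q I (N G J))) ⟩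
      ∣ J ∩ N G I″ ∣ + ∣ N G J ∣   ≡⟨ +-comm (∣ J ∩ N G I″ ∣) (∣ N G J ∣) ⟩
      ∣ N G J ∣ + ∣ J ∩ N G I″ ∣   ≡⟨ sym ∣W∣≡∣NJ∣+∣J∩NI″∣ ⟩
      ∣ W ∣                       ∎)

  -- A ⊆ N(J) is tight when the Hall inequality of critical⇒∣S∣≤∣J∩NS∣ holds with equality.
  Tight : Subset n → Subset n → Set
  Tight J A = A ⊆ N G J × ∣ J ∩ N G A ∣ ≤ ∣ A ∣

  ∅-tight : Tight J ∅
  ∅-tight {J} = (λ x∈∅ → ⊥-elim (∉⊥ x∈∅)) , p⊆q⇒∣p∣≤∣q∣ (N-∅ ∘ p∩q⊆q J (N G ∅))

  tight-∪ : Critical G J → Tight J A → Tight J B → Tight J (A ∪ B)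
  tight-∪ {J} {A} {B} J-crit (A⊆NJ , A-tight) (B⊆NJ , B-tight) = ∪-least A⊆NJ B⊆NJ ,
    arithmetic (∣ J ∩ N G (A ∪ B) ∣) (∣ J ∩ N G (A ∩ B) ∣) (∣ J ∩ N G A ∣) (∣ J ∩ N G B ∣)
               (∣ A ∣) (∣ B ∣) (∣ A ∪ B ∣) (∣ A ∩ B ∣)
      (p⊆r∪s∧q⊆r∩s⇒∣p∣+∣q∣≤∣r∣+∣s∣ J∩N⟨A∪B⟩⊆ J∩N⟨A∩B⟩⊆) A-tight B-tight (∣p∪q∣+∣p∩q∣≡∣p∣+∣q∣ A B)
      (critical⇒∣S∣≤∣J∩NS∣ J-crit (A⊆NJ ∘ p∩q⊆p A B))
    where
    J∩N⟨A∪B⟩⊆ : J ∩ N G (A ∪ B) ⊆ (J ∩ N G A) ∪ (J ∩ N G B)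
    J∩N⟨A∪B⟩⊆ x∈J∩N⟨A∪B⟩ with x∈p∩q⁻ J _ x∈J∩N⟨A∪B⟩
    ... | x∈J , x∈N⟨A∪B⟩ =
      [ (λ x∈NA → p⊆p∪q _ (x∈p∩q⁺ (x∈J , x∈NA))) , (λ x∈NB → q⊆p∪q _ _ (x∈p∩q⁺ (x∈J , x∈NB))) ]′
        (x∈p∪q⁻ (N G A) (N G B) (N-∪ x∈N⟨A∪B⟩))

    J∩N⟨A∩B⟩⊆ : J ∩ N G (A ∩ B) ⊆ (J ∩ N G A) ∩ (J ∩ N G B)
    J∩N⟨A∩B⟩⊆ x∈J∩N⟨A∩B⟩ with x∈p∩q⁻ J _ x∈J∩N⟨A∩B⟩
    ... | x∈J , x∈N⟨A∩B⟩ with x∈p∩q⁻ (N G A) (N G B) (N-∩ x∈N⟨A∩B⟩)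
    ...   | x∈NA , x∈NB = x∈p∩q⁺ (x∈p∩q⁺ (x∈J , x∈NA) , x∈p∩q⁺ (x∈J , x∈NB))

    arithmetic : ∀ u′ i′ a′ b′ a b u i → u′ + i′ ≤ a′ + b′ → a′ ≤ a → b′ ≤ b → u + i ≡ a + b →
                 i ≤ i′ → u′ ≤ u
    arithmetic u′ i′ a′ b′ a b u i submodular a-tight b-tight inclusion-exclusion hall =
      +-cancelʳ-≤ i′ u′ u (begin
        u′ + i′     ≤⟨ submodular ⟩
        a′ + b′     ≤⟨ +-mono-≤ a-tight b-tight ⟩
        a + b       ≡⟨ sym inclusion-exclusion ⟩
        u + i       ≤⟨ +-monoʳ-≤ u hall ⟩
        u + i′      ∎)
      where open ≤-Reasoning

  maximumCritical⇒critical∩NJ-tight : MaximumCritical G J → Critical G I → Tight J (I ∩ N G J)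
  maximumCritical⇒critical∩NJ-tight {J} {I} J-max I-crit =
    p∩q⊆q I (N G J) , +-cancelˡ-≤ ∣ N G J ∣ _ _ (begin
      ∣ N G J ∣ + ∣ J ∩ N G I″ ∣   ≤⟨ Disjoint⇒∣p∣+∣q∣≤∣r∣ NJ∩J=∅ (N-mono (q⊆p∪q I J)) J∩NI″⊆N⟨I∪J⟩ ⟩
      ∣ N G (I ∪ J) ∣             ≤⟨ ∣N⟨I∪J⟩∣≤∣I∩NJ∣+∣NJ∣ J-max I-crit ⟩
      ∣ I″ ∣ + ∣ N G J ∣           ≡⟨ +-comm (∣ I″ ∣) (∣ N G J ∣) ⟩
      ∣ N G J ∣ + ∣ I″ ∣           ∎)
    where
    open ≤-Reasoning
    I″ : Subset n
    I″ = I ∩ N G J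

    NJ∩J=∅ : Disjoint (N G J) (J ∩ N G I″)
    NJ∩J=∅ x∈NJ x∈J∩NI″ = independent⇒Disjoint-N (proj₁ (proj₁ J-max)) (p∩q⊆p J _ x∈J∩NI″) x∈NJ

    J∩NI″⊆N⟨I∪J⟩ : J ∩ N G I″ ⊆ N G (I ∪ J)
    J∩NI″⊆N⟨I∪J⟩ = N-mono (p⊆p∪q J ∘ p∩q⊆p I (N G J)) ∘ p∩q⊆q J (N G I″)

  -- A fixed maximum critical independent set J

  module _ {J : Subset n} (J-max : MaximumCritical G J) where

    private
      J-crit : Critical G J
      J-crit = proj₁ J-max

      J-ind : Independent G J
      J-ind = proj₁ J-crit

    L⇔N[J] : L G v ⇔ v ∈ N[ J ]
    L⇔N[J] = mk⇔ L⇒N[J] λ v∈N[J] → J , J-max , x∈p∪q⁻ J (N G J) v∈N[J]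
      where
      L⇒N[J] : L G v → v ∈ N[ J ]
      L⇒N[J] (J′ , J′-max , inj₁ v∈J′)  = maximumCritical⇒critical⊆N[J] J-max (proj₁ J′-max) v∈J′
      L⇒N[J] (J′ , J′-max , inj₂ v∈NJ′) = maximumCritical⇒N⟨critical⟩⊆N[J] J-max (proj₁ J′-max) v∈NJ′

    Lᶜ? : Decidable (Lᶜ G)
    Lᶜ? v = ¬? (map′ (from L⇔N[J]) (to L⇔N[J]) (v ∈? N[ J ]))

    independentInLᶜ⇔ : IndependentIn G (Lᶜ G) X ⇔ (Independent G X × Disjoint X N[ J ])
    independentInLᶜ⇔ = mk⇔
      (λ (X⊆Lᶜ , X-ind) → X-ind , λ x∈X x∈N[J] → X⊆Lᶜ _ x∈X (from L⇔N[J] x∈N[J]))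
      (λ (X-ind , X∩N[J]=∅) → (λ _ x∈X x∈L → X∩N[J]=∅ x∈X (to L⇔N[J] x∈L)) , X-ind)

    S─N[J]-independentInLᶜ : Independent G S → IndependentIn G (Lᶜ G) (S ─ N[ J ])
    S─N[J]-independentInLᶜ {S} S-ind =
      from independentInLᶜ⇔ (independent-⊆ S-ind (p─q⊆p S N[ J ]) , x∈p─q⇒x∉q S N[ J ])

    maximumCritical∪independentInLᶜ : MaximumCritical G I → IndependentIn G (Lᶜ G) X →
                                       Independent G (I ∪ X) × ∣ I ∪ X ∣ ≡ ∣ I ∣ + ∣ X ∣
    maximumCritical∪independentInLᶜ {I} {X} I-max X-inLᶜ with to independentInLᶜ⇔ X-inLᶜ
    ... | X-ind , X∩N[J]=∅ =
      independent-∪ (proj₁ (proj₁ I-max)) X-ind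
        (λ x∈X x∈NI → X∩N[J]=∅ x∈X (maximumCritical⇒N⟨critical⟩⊆N[J] J-max (proj₁ I-max) x∈NI)) ,
      Disjoint⇒∣p∪q∣≡∣p∣+∣q∣ I X
        (λ x∈I x∈X → X∩N[J]=∅ x∈X (maximumCritical⇒critical⊆N[J] J-max (proj₁ I-max) x∈I))

    diadem⊆corona∩L : ∀ v → diadem G v → corona G v × L G v
    diadem⊆corona∩L v (I , I-crit , v∈I) =
      corona-from (critical⊆maximumIndependent I-crit) ,
      from L⇔N[J] (maximumCritical⇒critical⊆N[J] J-max I-crit v∈I)
      where
      corona-from : ∃[ S ] MaximumIndependent S × I ⊆ S → corona G v
      corona-from (S , S-max , I⊆S) = S , S-max , I⊆S v∈I

    TightDiadem : Subset n → Set
    TightDiadem A = Tight J A × Lift (diadem G) A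

    -- D is diadem(G) ∩ N(J) (see critical∩NJ⊆D); choosing it as a largest tight subset of the diadem
    -- avoids forming a union over all critical sets.
    private
      maximumTightDiadem : ∃ (Maximises TightDiadem ∣_∣)
      maximumTightDiadem = maximiser-exists
        (λ A → ((A ⊆? N G J) ×-dec (∣ J ∩ N G A ∣ ≤? ∣ A ∣)) ×-dec Lift? diadem? A) ∣_∣ n (λ A _ → ∣p∣≤n A)
        (∅ , ∅-tight , λ x∈∅ → ⊥-elim (∉⊥ x∈∅))

      D : Subset n
      D = proj₁ maximumTightDiadem

      D-tight : Tight J D
      D-tight = proj₁ (proj₁ (proj₂ maximumTightDiadem))

      D⊆diadem : Lift (diadem G) D
      D⊆diadem = proj₂ (proj₁ (proj₂ maximumTightDiadem))

      critical∩NJ⊆D : Critical G I → I ∩ N G J ⊆ D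
      critical∩NJ⊆D {I} I-crit =
        p⊆q∧∣q∣≤∣p∣⇒q⊆p (p⊆p∪q _) (proj₂ (proj₂ maximumTightDiadem) _ D∪I″-tightDiadem) ∘ q⊆p∪q D _
        where
        D∪I″-tightDiadem : TightDiadem (D ∪ (I ∩ N G J))
        D∪I″-tightDiadem = tight-∪ J-crit D-tight (maximumCritical⇒critical∩NJ-tight J-max I-crit) ,
          λ x∈D∪I″ → [ D⊆diadem , (λ x∈I″ → I , I-crit , p∩q⊆p I (N G J) x∈I″) ]′ (x∈p∪q⁻ D _ x∈D∪I″)

      J─ND⊆nucleus : x ∈ J → x ∉ N G D → nucleus G x
      J─ND⊆nucleus {x} x∈J x∉ND J′ J′-max = decidable-stable (x ∈? J′) λ x∉J′ →
        [ x∉J′ , (λ x∈NJ′ → x∉ND (neighbour-in-D (∈N⁻ x∈NJ′))) ]′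
          (x∈p∪q⁻ J′ (N G J′) (maximumCritical⇒critical⊆N[J] J′-max J-crit x∈J))
        where
        neighbour-in-D : ∃[ u ] u ∈ J′ × adj G u x ≡ true → x ∈ N G D
        neighbour-in-D (u , u∈J′ , ux)
          with x∈p∪q⁻ J (N G J) (maximumCritical⇒critical⊆N[J] J-max (proj₁ J′-max) u∈J′)
        ... | inj₁ u∈J  = ⊥-elim (independent⇒Disjoint-N J-ind x∈J (∈N⁺ u∈J ux))
        ... | inj₂ u∈NJ = ∈N⁺ (critical∩NJ⊆D (proj₁ J′-max) (x∈p∩q⁺ (u∈J′ , u∈NJ))) ux

      nucleus⊆core⇒S∩NJ⊆D : (∀ v → nucleus G v → core G v) → MaximumIndependent S → S ∩ N G J ⊆ D
      nucleus⊆core⇒S∩NJ⊆D {S} nucleus⊆core S-max = P∪D⊆D ∘ p⊆p∪q D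
        where
        open ≤-Reasoning
        P : Subset n
        P = S ∩ N G J

        J∩N⟨P∪D⟩⊆ND : J ∩ N G (P ∪ D) ⊆ N G D
        J∩N⟨P∪D⟩⊆ND {x} x∈J∩N⟨P∪D⟩ = decidable-stable (x ∈? N G D) λ x∉ND →
          [ (λ x∈NP → independent⇒Disjoint-N (proj₂ (proj₁ S-max))
                        (nucleus⊆core x (J─ND⊆nucleus (p∩q⊆p J _ x∈J∩N⟨P∪D⟩) x∉ND) S S-max)
                        (N-mono (p∩q⊆p S (N G J)) x∈NP))
          , x∉ND ]′ (x∈p∪q⁻ (N G P) (N G D) (N-∪ (p∩q⊆q J _ x∈J∩N⟨P∪D⟩)))

        P∪D⊆D : P ∪ D ⊆ D
        P∪D⊆D = p⊆q∧∣q∣≤∣p∣⇒q⊆p (q⊆p∪q P D) (begin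
          ∣ P ∪ D ∣             ≤⟨ critical⇒∣S∣≤∣J∩NS∣ J-crit (∪-least (p∩q⊆q S (N G J)) (proj₁ D-tight)) ⟩
          ∣ J ∩ N G (P ∪ D) ∣   ≤⟨ p⊆q⇒∣p∣≤∣q∣ (λ h → x∈p∩q⁺ (p∩q⊆p J _ h , J∩N⟨P∪D⟩⊆ND h)) ⟩
          ∣ J ∩ N G D ∣         ≤⟨ proj₂ D-tight ⟩
          ∣ D ∣                 ∎)

    nucleus⊆core⇒corona∩L⊆diadem : (∀ v → nucleus G v → core G v) →
                                   ∀ v → corona G v × L G v → diadem G v
    nucleus⊆core⇒corona∩L⊆diadem nucleus⊆core v ((S , S-max , v∈S) , v∈L) =
      [ (λ v∈J → J , J-crit , v∈J)
      , (λ v∈NJ → D⊆diadem (nucleus⊆core⇒S∩NJ⊆D nucleus⊆core S-max (x∈p∩q⁺ (v∈S , v∈NJ)))) ]′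
        (x∈p∪q⁻ J (N G J) (to L⇔N[J] v∈L))

    module _ {T : Subset n} (T-max : MaximumIndependentIn G (Lᶜ G) T) where

      T∩N[J]=∅ : Disjoint T N[ J ]
      T∩N[J]=∅ = proj₂ (to independentInLᶜ⇔ (proj₁ T-max))

      maximumIndependent⇒∣S∩N[J]∣≡∣J∣×∣S─N[J]∣≡∣T∣ :
        MaximumIndependent S → ∣ S ∩ N[ J ] ∣ ≡ ∣ J ∣ × ∣ S ─ N[ J ] ∣ ≡ ∣ T ∣
      maximumIndependent⇒∣S∩N[J]∣≡∣J∣×∣S─N[J]∣≡∣T∣ {S} ((_ , S-ind) , S-max) =
        +-squeeze (critical⇒∣K∩N[J]∣≤∣J∣ J-crit S-ind) (proj₂ T-max _ (S─N[J]-independentInLᶜ S-ind)) (begin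
          ∣ J ∣ + ∣ T ∣                     ≡⟨ sym (proj₂ J∪T) ⟩
          ∣ J ∪ T ∣                        ≤⟨ S-max (J ∪ T) ((λ _ _ → tt) , proj₁ J∪T) ⟩
          ∣ S ∣                            ≡⟨ ∣p∣≡∣p∩q∣+∣p─q∣ S N[ J ] ⟩
          ∣ S ∩ N[ J ] ∣ + ∣ S ─ N[ J ] ∣   ∎)
        where
        open ≤-Reasoning
        J∪T : Independent G (J ∪ T) × ∣ J ∪ T ∣ ≡ ∣ J ∣ + ∣ T ∣
        J∪T = maximumCritical∪independentInLᶜ J-max (proj₁ T-max)

      maximumIndependent⇒S─N[J]-maximumInLᶜ :
        MaximumIndependent S → MaximumIndependentIn G (Lᶜ G) (S ─ N[ J ])
      maximumIndependent⇒S─N[J]-maximumInLᶜ S-max = S─N[J]-independentInLᶜ (proj₂ (proj₁ S-max)) ,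
        λ Y Y-inLᶜ → subst (∣ Y ∣ ≤_) (sym (proj₂ (maximumIndependent⇒∣S∩N[J]∣≡∣J∣×∣S─N[J]∣≡∣T∣ S-max)))
                                      (proj₂ T-max Y Y-inLᶜ)

      maximumCritical∪maximumInLᶜ⇒maximumIndependent :
        MaximumCritical G I → MaximumIndependentIn G (Lᶜ G) X → MaximumIndependent (I ∪ X)
      maximumCritical∪maximumInLᶜ⇒maximumIndependent {I} {X} I-max X-max =
        ((λ _ _ → tt) , proj₁ I∪X) , λ Y (_ , Y-ind) → begin
          ∣ Y ∣                             ≡⟨ ∣p∣≡∣p∩q∣+∣p─q∣ Y N[ J ] ⟩
          ∣ Y ∩ N[ J ] ∣ + ∣ Y ─ N[ J ] ∣    ≤⟨ +-mono-≤ (critical⇒∣K∩N[J]∣≤∣J∣ J-crit Y-ind)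
                                                        (proj₂ T-max _ (S─N[J]-independentInLᶜ Y-ind)) ⟩
          ∣ J ∣ + ∣ T ∣                     ≡⟨ cong₂ _+_ ∣J∣≡∣I∣ ∣T∣≡∣X∣ ⟩
          ∣ I ∣ + ∣ X ∣                     ≡⟨ sym (proj₂ I∪X) ⟩
          ∣ I ∪ X ∣                         ∎
        where
        open ≤-Reasoning
        I∪X : Independent G (I ∪ X) × ∣ I ∪ X ∣ ≡ ∣ I ∣ + ∣ X ∣
        I∪X = maximumCritical∪independentInLᶜ I-max (proj₁ X-max)

        ∣J∣≡∣I∣ : ∣ J ∣ ≡ ∣ I ∣
        ∣J∣≡∣I∣ = ≤-antisym (proj₂ I-max J J-crit) (proj₂ J-max I (proj₁ I-max))

        ∣T∣≡∣X∣ : ∣ T ∣ ≡ ∣ X ∣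
        ∣T∣≡∣X∣ = ≤-antisym (proj₂ X-max T (proj₁ T-max)) (proj₂ T-max X (proj₁ X-max))

      core⊆nucleus⇒coreLᶜ=∅ : (∀ v → core G v → nucleus G v) → ∀ v → ¬ coreLᶜ G v
      core⊆nucleus⇒coreLᶜ=∅ core⊆nucleus v v∈coreLᶜ = T∩N[J]=∅ (v∈coreLᶜ T T-max) (p⊆p∪q (N G J) v∈J)
        where
        v∈core : core G v
        v∈core S S-max = p─q⊆p S N[ J ] (v∈coreLᶜ _ (maximumIndependent⇒S─N[J]-maximumInLᶜ S-max))

        v∈J : v ∈ J
        v∈J = core⊆nucleus v v∈core J J-max

      coreLᶜ=∅⇒core⊆nucleus : (∀ v → ¬ coreLᶜ G v) → ∀ v → core G v → nucleus G v
      coreLᶜ=∅⇒core⊆nucleus coreLᶜ=∅ v v∈core I I-max =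
        [ id , (λ v∈T → ⊥-elim (coreLᶜ=∅ v (v∈coreLᶜ v∈T))) ]′
          (x∈p∪q⁻ I T (v∈core _ (maximumCritical∪maximumInLᶜ⇒maximumIndependent I-max T-max)))
        where
        v∈coreLᶜ : v ∈ T → coreLᶜ G v
        v∈coreLᶜ v∈T X X-max =
          [ (λ v∈J → ⊥-elim (T∩N[J]=∅ v∈T (p⊆p∪q (N G J) v∈J))) , id ]′
            (x∈p∪q⁻ J X (v∈core _ (maximumCritical∪maximumInLᶜ⇒maximumIndependent J-max X-max)))

      corona∩L⊆diadem⇒nucleus⊆core : (∀ v → corona G v × L G v → diadem G v) →
                                     ∀ v → nucleus G v → core G v
      corona∩L⊆diadem⇒nucleus⊆core corona∩L⊆diadem v v∈nucleus S S-max =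
        p∩q⊆p S N[ J ] (v∈nucleus M M-max)
        where
        M : Subset n
        M = S ∩ N[ J ]

        M-ind : Independent G M
        M-ind = independent-⊆ (proj₂ (proj₁ S-max)) (p∩q⊆p S N[ J ])

        NM⊆N[J] : N G M ⊆ N[ J ]
        NM⊆N[J] w∈NM with ∈N⁻ w∈NM
        ... | u , u∈M , uw
          with corona∩L⊆diadem u ((S , S-max , p∩q⊆p S N[ J ] u∈M) , from L⇔N[J] (p∩q⊆q S N[ J ] u∈M))
        ...   | I , I-crit , u∈I = maximumCritical⇒N⟨critical⟩⊆N[J] J-max I-crit (∈N⁺ u∈I uw)

        ∣M∣+∣NM∣≤∣J∣+∣NJ∣ : ∣ M ∣ + ∣ N G M ∣ ≤ ∣ J ∣ + ∣ N G J ∣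
        ∣M∣+∣NM∣≤∣J∣+∣NJ∣ =
          subst (∣ M ∣ + ∣ N G M ∣ ≤_) (Disjoint⇒∣p∪q∣≡∣p∣+∣q∣ J (N G J) (independent⇒Disjoint-N J-ind))
                (Disjoint⇒∣p∣+∣q∣≤∣r∣ (independent⇒Disjoint-N M-ind) (p∩q⊆q S N[ J ]) NM⊆N[J])

        ∣M∣≡∣J∣ : ∣ M ∣ ≡ ∣ J ∣
        ∣M∣≡∣J∣ = proj₁ (maximumIndependent⇒∣S∩N[J]∣≡∣J∣×∣S─N[J]∣≡∣T∣ S-max)

        M-max : MaximumCritical G M
        M-max = defect≥critical⇒critical J-crit M-ind
                  (subst₂ (λ k j → k + ∣ N G M ∣ ≤ j + ∣ N G J ∣) ∣M∣≡∣J∣ (sym ∣M∣≡∣J∣) ∣M∣+∣NM∣≤∣J∣+∣NJ∣) ,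
                λ C C-crit → subst (∣ C ∣ ≤_) (sym ∣M∣≡∣J∣) (proj₂ J-max C C-crit)

mainTheorem10 : (n : ℕ) (G : Graph n) →
    (∀ v → core G v ⇔ nucleus G v) ⇔
    ((∀ v → ¬ coreLᶜ G v) × (∀ v → diadem G v ⇔ (corona G v × L G v)))
mainTheorem10 n G = mk⇔
  (λ core⇔nucleus →
      core⊆nucleus⇒coreLᶜ=∅ G J-max T-max (λ v → to (core⇔nucleus v)) ,
      λ v → mk⇔ (diadem⊆corona∩L G J-max v)
                (nucleus⊆core⇒corona∩L⊆diadem G J-max (λ v → from (core⇔nucleus v)) v))
  (λ (coreLᶜ=∅ , diadem⇔corona∩L) v → mk⇔
      (coreLᶜ=∅⇒core⊆nucleus G J-max T-max coreLᶜ=∅ v)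
      (corona∩L⊆diadem⇒nucleus⊆core G J-max T-max (λ v → from (diadem⇔corona∩L v)) v))
  where
  J-max : MaximumCritical G (proj₁ (maximumCritical-exists G))
  J-max = proj₂ (maximumCritical-exists G)

  T-max : MaximumIndependentIn G (Lᶜ G) (proj₁ (maximumIndependentIn-exists G (Lᶜ? G J-max)))
  T-max = proj₂ (maximumIndependentIn-exists G (Lᶜ? G J-max))
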